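{- Let $\alpha,\gamma$ be scalar umbrae with $\gamma$ provided with a compositional inverse, and let $\{s_n(x)\}$ be the moments of a Sheffer umbra for $(\alpha,\gamma)$. Then $\{s_n(x)\}$ is the unique polynomial sequence such that $$s_n(\alpha+k.\gamma)\simeq (k.\chi)^n,\quad\text{i.e. } E[s_n(\alpha+k.\gamma)]=(k)_n=k(k-1)\cdots(k-n+1),$$ for all integers $n,k\ge0$ (here $\alpha$ and $k.\gamma$ are uncorrelated and $s_n(\alpha+k.\gamma)=\sum_j s_{n,j}(\alpha+k.\gamma)^j$ if $s_n(x)=\sum_j s_{n,j}x^j$).
   Context: Setting (classical umbral calculus). $R$ is a commutative integral domain whose quotient field has characteristic $0$. Umbrae are symbols with a linear evaluation $E$, $E[1]=1$, multiplicative on products of powers of pairwise distinct umbrae. Moments $a_n=E[\alpha^n]$, g.f. $f(\alpha,t)=\sum a_nt^n/n!$; $p\simeq q$ means $E[p]=E[q]$; $\alpha\equiv\gamma$ iff equal g.f. Saturation: umbral expressions denote auxiliary umbrae determined up to similarity by their g.f.; distinct ones in a sum are uncorrelated. Special umbrae: unity $u$ ($e^t$), singleton $\chi$ ($1+t$), Bell $\beta$ ($\exp(e^t-1)$). G.f. rules: $f(\alpha+\gamma,t)=f(\alpha,t)f(\gamma,t)$; for a scalar $c$ (integer or indeterminate), $f(c.\alpha,t)=f(\alpha,t)^c$ (so $k.\chi$ has moments $(k)_n$, $x.u$ has moments $x^n$, $-1.\alpha$ has g.f. $1/f(\alpha,t)$); $f(\gamma.\alpha,t)=f(\gamma,\log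 f(\alpha,t))$ for umbrae, dot-products associate. $\gamma$ is provided with a compositional inverse if $E[\gamma]\ne0$ and $f(\gamma,t)-1$ has a compositional inverse series $h_\gamma$; then $\gamma^{<-1>}$ has g.f. $1+h_\gamma(t)$ and the adjoint $\gamma^*=\beta.\gamma^{<-1>}$ has g.f. $\exp(h_\gamma(t))$. Scalar umbra: moments in $R$. A polynomial umbra $\sigma_x$ has moments $s_n(x)\in R[x]$, $s_0=1$, $\deg s_n=n$. It is a Sheffer umbra for $(\alpha,\gamma)$ if $\sigma_x\equiv(-1.\alpha+x.u).\gamma^*$, i.e. its g.f. is $e^{xh_\gamma(t)}/f(\alpha,h_\gamma(t))$. -}

module Defs where

open import Level using (_⊔_)
open import Data.Nat using (ℕ; zero; suc; _∸_; _<_)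
import Data.Nat as ℕ
open import Data.Nat.Combinatorics using (_C_)
open import Data.Nat using (_!)
open import Data.Product using (_×_)
open import Data.Sum using (_⊎_)
open import Relation.Nullary using (¬_)
open import Algebra.Bundles using (CommutativeRing)

-- Falling factorial (k)_n = k (k-1) ... (k-n+1), computed in ℕ.
-- (k ∸ n is only truncated once a factor 0 has already appeared.)
falling : ℕ → ℕ → ℕ
falling k zero = 1
falling k (suc n) = falling k n ℕ.* (k ∸ n)

module Umbral {c ℓ} (R : CommutativeRing c ℓ) where
  open CommutativeRing R

  -- A sequence of moments / exponential coefficients: n ↦ a_n.
  Seq : Set c
  Seq = ℕ → Carrier

  natR : ℕ → Carrier
  natR zero = 0#
  natR (suc n) = 1# + natR n

  sumTo : ℕ → (ℕ → Carrier) → Carrier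
  sumTo zero f = f 0
  sumTo (suc n) f = sumTo n f + f (suc n)

  sign : ℕ → Carrier
  sign zero = 1#
  sign (suc n) = - sign n

  -- Moments of a sum of two uncorrelated umbrae (product of e.g.f.s):
  -- E[(α+γ)^n] = Σ_i C(n,i) a_i g_{n-i}.
  conv : Seq → Seq → Seq
  conv a b n = sumTo n (λ i → natR (n C i) * (a i * b (n ∸ i)))

  -- Moments of the augmentation umbra ε (e.g.f. 1).
  δ₀ : Seq
  δ₀ zero = 1#
  δ₀ (suc n) = 0#

  -- Moments of k.α (e.g.f. f(α,t)^k), k a nonnegative integer.
  dotPow : ℕ → Seq → Seq
  dotPow zero a = δ₀
  dotPow (suc k) a = conv a (dotPow k a)

  -- Partial Bell polynomials B_{n,k}(x_1, x_2, ...): exponential coefficients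
  -- of H(t)^k / k!, where H(t) = Σ_{i≥1} x_i t^i / i!  (x_0 is ignored).
  bell : Seq → ℕ → ℕ → Carrier
  bell x zero zero = 1#
  bell x zero (suc n) = 0#
  bell x (suc k) zero = 0#
  bell x (suc k) (suc n) =
    sumTo n (λ i → natR (n C i) * (x (suc i) * bell x k (n ∸ i)))

  -- Composition of exponential series F(H(t)) (H with zero constant term;
  -- the constant coefficient of the second argument is ignored):
  -- [t^n/n!] F(H(t)) = Σ_{k=0}^{n} F_k B_{n,k}(H).
  compose : Seq → Seq → Seq
  compose F H n = sumTo n (λ k → F k * bell H k n)

  -- Exponential coefficients of 1/(1+u) = Σ (-1)^k k! u^k / k!.
  recipSeries : Seq
  recipSeries k = sign k * natR (k !)

  -- Moments of -1.α, i.e. e.g.f. 1/f(α,t) = 1/(1 + (f(α,t)-1)).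
  negDot : Seq → Seq
  negDot a = compose recipSeries a

  -- Moments of the singleton umbra χ: e.g.f. 1 + t.
  χseq : Seq
  χseq zero = 1#
  χseq (suc zero) = 1#
  χseq (suc (suc n)) = 0#

  tSeq : Seq
  tSeq zero = 0#
  tSeq (suc zero) = 1#
  tSeq (suc (suc n)) = 0#

  IsScalarUmbra : Seq → Set ℓ
  IsScalarUmbra a = a 0 ≈ 1#

  -- h is the (two-sided) compositional inverse series of f(γ,t) - 1.
  IsCompInverse : Seq → Seq → Set ℓ
  IsCompInverse g h =
    (h 0 ≈ 0#)
    × (∀ n → compose g h n ≈ χseq n)     -- f(γ, h(t)) = 1 + t, i.e. (f(γ,·)-1)∘h = t
    × (∀ n → compose h g n ≈ tSeq n)     -- h(f(γ,t) - 1) = t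

  HasCompInverse : Seq → Seq → Set ℓ
  HasCompInverse g h = (¬ (g 1 ≈ 0#)) × IsCompInverse g h

  -- A polynomial sequence given by coefficients: p n j = coefficient of x^j
  -- in p_n(x); deg p_n = n.
  IsPolySeq : (ℕ → ℕ → Carrier) → Set ℓ
  IsPolySeq p = (∀ n j → n < j → p n j ≈ 0#) × (∀ n → ¬ (p n n ≈ 0#))

  IsPolyUmbraMoments : (ℕ → ℕ → Carrier) → Set ℓ
  IsPolyUmbraMoments s = IsPolySeq s × (s 0 0 ≈ 1#)

  -- Sheffer umbra for (α,γ), where h = h_γ: the g.f. Σ s_n(x) t^n/n! equals
  -- e^{x h(t)} / f(α, h(t)).  Comparing coefficients of x^j t^n/n!:
  -- s_{n,j} = Σ_i C(n,i) B_{i,j}(h) · [t^{n-i}/(n-i)!] (1/f(α,·))(h(t)).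
  IsShefferMoments : Seq → Seq → (ℕ → ℕ → Carrier) → Set ℓ
  IsShefferMoments a h s =
    IsPolyUmbraMoments s
    × (∀ n j → s n j ≈ conv (bell h j) (compose (negDot a) h) n)

  -- E[p_n(ω)] for an umbra ω with moments m (deg p_n ≤ n):
  -- Σ_j p_{n,j} m_j.
  evalPoly : (ℕ → ℕ → Carrier) → ℕ → Seq → Carrier
  evalPoly p n m = sumTo n (λ j → p n j * m j)

  Characterizes : Seq → Seq → (ℕ → ℕ → Carrier) → Set ℓ
  Characterizes a g p = ∀ n k → evalPoly p n (conv a (dotPow k g)) ≈ natR (falling k n)

IsIntegralDomain : ∀ {c ℓ} → CommutativeRing c ℓ → Set (c ⊔ ℓ)
IsIntegralDomain R = (¬ (1# ≈ 0#)) × (∀ x y → x * y ≈ 0# → (x ≈ 0#) ⊎ (y ≈ 0#))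
  where open CommutativeRing R

-- The quotient field has characteristic 0 (for a domain: n·1 ≠ 0 for n ≥ 1).
HasCharZero : ∀ {c ℓ} → CommutativeRing c ℓ → Set ℓ
HasCharZero R = ∀ n → ¬ (natR (suc n) ≈ 0#)
  where open CommutativeRing R
        open Umbral R using (natR)

-- Read everything as exponential power series, with convolution as product and
-- compose F H as F(H(t)).  Composition with h is multiplicative, so the moments
-- f(α,t) f(γ,t)^k of α + k.γ go to f(α,h(t)) (1+t)^k, while the Sheffer series
-- is 1/f(α,h(t)) · e^{x h(t)}; evaluating s_n at α + k.γ therefore yields the
-- coefficients of (1+t)^k, i.e. the falling factorials (k)_n.
-- For uniqueness, s is triangular with unit diagonal s_{l,l} = h_1^l (h_1 g_1 = 1),
-- so the difference of two solutions expands in the s_l with coefficients c_l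
-- satisfying Σ_l c_l (k)_l = 0 for all k; evaluating at k = 0, 1, 2, ... kills
-- them one by one, because (l)_l = l! ≠ 0 in a domain of characteristic zero.
module Submission where

open import Defs
open import Data.Empty using (⊥-elim)
open import Data.Nat using (ℕ; zero; suc; _∸_; _≤_; _<_; z≤n; s≤s; _!; NonZero)
import Data.Nat as ℕ
import Data.Nat.Properties as ℕₚ
open import Data.Nat.Combinatorics using (_C_; nCk+nC[k+1]≡[n+1]C[k+1]; k>n⇒nCk≡0; nCn≡1; nC1≡n)
open import Data.Nat.Induction using (<-rec)
open import Data.Product using (_×_; _,_; proj₁; proj₂; Σ-syntax)
open import Data.Sum using (inj₁; inj₂)
open import Relation.Nullary using (¬_; yes; no)
open import Relation.Binary.Definitions using (tri<; tri≈; tri>)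
open import Relation.Binary.PropositionalEquality as ≡ using (_≡_; _≢_)
open import Algebra.Bundles using (CommutativeRing)
import Algebra.Properties.CommutativeSemigroup as CommutativeSemigroupProperties
open import Level using (_⊔_)

falling-zero : ∀ {k n} → k < n → falling k n ≡ 0
falling-zero {k} {suc n} (s≤s k≤n) with ℕₚ.m≤n⇒m<n∨m≡n k≤n
... | inj₁ k<n    rewrite falling-zero k<n = ≡.refl
... | inj₂ ≡.refl rewrite ℕₚ.n∸n≡0 k      = ℕₚ.*-zeroʳ (falling k k)

falling-nonZero : ∀ {k n} → n ≤ k → NonZero (falling k n)
falling-nonZero {n = zero}  _   = _
falling-nonZero {k} {suc n} n<k =
  let instance
        _ = falling-nonZero {k} {n} (ℕₚ.<⇒≤ n<k)
        _ = ℕ.>-nonZero (ℕₚ.m<n⇒0<n∸m n<k)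
  in ℕₚ.m*n≢0 (falling k n) (k ∸ n)

falling-suc : ∀ k n → falling (suc k) (suc n) ≡ suc k ℕ.* falling k n
falling-suc k zero    = ℕₚ.*-comm 1 (suc k)
falling-suc k (suc n) rewrite falling-suc k n = ℕₚ.*-assoc (suc k) (falling k n) (k ∸ n)

falling-pascal : ∀ k n → falling (suc k) (suc n) ≡ falling k (suc n) ℕ.+ suc n ℕ.* falling k n
falling-pascal k n with ℕₚ.≤-<-connex n k
... | inj₁ n≤k = begin
  falling (suc k) (suc n)                            ≡⟨ falling-suc k n ⟩
  suc k ℕ.* falling k n                              ≡⟨ ≡.cong (ℕ._* falling k n) (ℕₚ.m∸n+n≡m (s≤s n≤k)) ⟨
  (k ∸ n ℕ.+ suc n) ℕ.* falling k n                  ≡⟨ ℕₚ.*-distribʳ-+ (falling k n) (k ∸ n) (suc n) ⟩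
  (k ∸ n) ℕ.* falling k n ℕ.+ suc n ℕ.* falling k n  ≡⟨ ≡.cong (ℕ._+ suc n ℕ.* falling k n) (ℕₚ.*-comm (k ∸ n) _) ⟩
  falling k (suc n) ℕ.+ suc n ℕ.* falling k n        ∎
  where open ≡.≡-Reasoning
... | inj₂ k<n rewrite falling-suc k n | falling-zero k<n | ℕₚ.*-zeroʳ k | ℕₚ.*-zeroʳ n = ≡.refl

module Series {c ℓ} (R : CommutativeRing c ℓ) where
  open CommutativeRing R hiding (zero)
  open Umbral R
  open import Algebra.Properties.Ring ring using (-‿distribˡ-*; [y-z]x≈yx-zx)
  open import Algebra.Properties.AbelianGroup +-abelianGroup using (⁻¹-∙-comm)
  open import Algebra.Properties.Group +-group using (//-rightDividesˡ; x≈y⇒x∙y⁻¹≈ε; x∙y⁻¹≈ε⇒x≈y)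
  open import Algebra.Properties.Semiring.Exp semiring using (_^_)
  module +-Props = CommutativeSemigroupProperties +-commutativeSemigroup
  module *-Props = CommutativeSemigroupProperties *-commutativeSemigroup
  open import Relation.Binary.Reasoning.Setoid setoid

  natR-1 : natR 1 ≈ 1#
  natR-1 = +-identityʳ 1#

  natR-cong : ∀ {m n} → m ≡ n → natR m ≈ natR n
  natR-cong ≡.refl = refl

  natR-+ : ∀ m n → natR (m ℕ.+ n) ≈ natR m + natR n
  natR-+ zero    n = sym (+-identityˡ _)
  natR-+ (suc m) n = trans (+-congˡ (natR-+ m n)) (sym (+-assoc _ _ _))

  natR-* : ∀ m n → natR (m ℕ.* n) ≈ natR m * natR n
  natR-* zero    n = sym (zeroˡ _)
  natR-* (suc m) n = begin
    natR (n ℕ.+ m ℕ.* n)          ≈⟨ natR-+ n (m ℕ.* n) ⟩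
    natR n + natR (m ℕ.* n)       ≈⟨ +-cong (sym (*-identityˡ _)) (natR-* m n) ⟩
    1# * natR n + natR m * natR n ≈⟨ distribʳ _ _ _ ⟨
    (1# + natR m) * natR n        ∎

  ^-inverse : ∀ {x y} → x * y ≈ 1# → ∀ l → x ^ l * y ^ l ≈ 1#
  ^-inverse xy≈1 zero    = *-identityʳ 1#
  ^-inverse xy≈1 (suc l) = begin
    _ ≈⟨ *-Props.interchange _ _ _ _ ⟩
    _ ≈⟨ *-cong xy≈1 (^-inverse xy≈1 l) ⟩
    _ ≈⟨ *-identityʳ 1# ⟩
    1# ∎

  sumTo-congᵢ : ∀ n {f g : ℕ → Carrier} → (∀ i → i ≤ n → f i ≈ g i) → sumTo n f ≈ sumTo n g
  sumTo-congᵢ zero    f≈g = f≈g 0 z≤n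
  sumTo-congᵢ (suc n) f≈g =
    +-cong (sumTo-congᵢ n (λ i i≤n → f≈g i (ℕₚ.m≤n⇒m≤1+n i≤n))) (f≈g (suc n) ℕₚ.≤-refl)

  sumTo-cong : ∀ n {f g : ℕ → Carrier} → (∀ i → f i ≈ g i) → sumTo n f ≈ sumTo n g
  sumTo-cong n f≈g = sumTo-congᵢ n (λ i _ → f≈g i)

  sumTo-+ : ∀ n (f g : ℕ → Carrier) → sumTo n (λ i → f i + g i) ≈ sumTo n f + sumTo n g
  sumTo-+ zero    f g = refl
  sumTo-+ (suc n) f g = trans (+-congʳ (sumTo-+ n f g)) (+-Props.interchange _ _ _ _)

  sumTo-- : ∀ n (f g : ℕ → Carrier) → sumTo n (λ i → f i - g i) ≈ sumTo n f - sumTo n g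
  sumTo-- n f g = trans (sumTo-+ n f (λ i → - g i)) (+-congˡ (sumTo-neg n))
    where
    sumTo-neg : ∀ n → sumTo n (λ i → - g i) ≈ - sumTo n g
    sumTo-neg zero    = refl
    sumTo-neg (suc n) = trans (+-congʳ (sumTo-neg n)) (⁻¹-∙-comm _ _)

  sumTo-*ˡ : ∀ n x (f : ℕ → Carrier) → x * sumTo n f ≈ sumTo n (λ i → x * f i)
  sumTo-*ˡ zero    x f = refl
  sumTo-*ˡ (suc n) x f = trans (distribˡ _ _ _) (+-congʳ (sumTo-*ˡ n x f))

  sumTo-*ʳ : ∀ n x (f : ℕ → Carrier) → sumTo n f * x ≈ sumTo n (λ i → f i * x)
  sumTo-*ʳ n x f = trans (*-comm _ _) (trans (sumTo-*ˡ n x f) (sumTo-cong n (λ i → *-comm _ _)))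

  sumTo-zero : ∀ n {f : ℕ → Carrier} → (∀ i → i ≤ n → f i ≈ 0#) → sumTo n f ≈ 0#
  sumTo-zero zero    f≈0 = f≈0 0 z≤n
  sumTo-zero (suc n) f≈0 = trans
    (+-cong (sumTo-zero n (λ i i≤n → f≈0 i (ℕₚ.m≤n⇒m≤1+n i≤n))) (f≈0 (suc n) ℕₚ.≤-refl))
    (+-identityʳ 0#)

  sumTo-shift : ∀ n (f : ℕ → Carrier) → sumTo (suc n) f ≈ f 0 + sumTo n (λ i → f (suc i))
  sumTo-shift zero    f = refl
  sumTo-shift (suc n) f = trans (+-congʳ (sumTo-shift n f)) (+-assoc _ _ _)

  sumTo-swap : ∀ n m (f : ℕ → ℕ → Carrier) →
               sumTo n (λ i → sumTo m (f i)) ≈ sumTo m (λ j → sumTo n (λ i → f i j))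
  sumTo-swap zero    m f = refl
  sumTo-swap (suc n) m f = trans (+-congʳ (sumTo-swap n m f)) (sym (sumTo-+ m _ _))

  sumTo-truncate : ∀ {m} n {f : ℕ → Carrier} → m ≤ n → (∀ i → m < i → i ≤ n → f i ≈ 0#) →
                   sumTo n f ≈ sumTo m f
  sumTo-truncate zero    z≤n   _   = refl
  sumTo-truncate (suc n) m≤1+n f≈0 with ℕₚ.m≤n⇒m<n∨m≡n m≤1+n
  ... | inj₂ ≡.refl    = refl
  ... | inj₁ (s≤s m≤n) = trans
    (+-cong (sumTo-truncate n m≤n (λ i m<i i≤n → f≈0 i m<i (ℕₚ.m≤n⇒m≤1+n i≤n)))
            (f≈0 (suc n) (s≤s m≤n) ℕₚ.≤-refl))
    (+-identityʳ _)

  sumTo-last : ∀ l {f : ℕ → Carrier} → (∀ i → i < l → f i ≈ 0#) → sumTo l f ≈ f l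
  sumTo-last zero    _   = refl
  sumTo-last (suc l) f≈0 = trans (+-congʳ (sumTo-zero l (λ i i≤l → f≈0 i (s≤s i≤l)))) (+-identityˡ _)

  sumTo-single : ∀ {l} n {f : ℕ → Carrier} → l ≤ n → (∀ i → i ≤ n → i ≢ l → f i ≈ 0#) →
                 sumTo n f ≈ f l
  sumTo-single {l} n l≤n f≈0 = trans
    (sumTo-truncate n l≤n (λ i l<i i≤n → f≈0 i i≤n (ℕₚ.>⇒≢ l<i)))
    (sumTo-last l (λ i i<l → f≈0 i (ℕₚ.≤-trans (ℕₚ.<⇒≤ i<l) l≤n) (ℕₚ.<⇒≢ i<l)))

  -- A record rather than a function type, so that the sequences are inferable from a proof.
  infix 4 _≐_
  record _≐_ (a b : Seq) : Set ℓ where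
    constructor pointwise
    field at : ∀ n → a n ≈ b n
  open _≐_ public

  ≐-refl : ∀ {a} → a ≐ a
  ≐-refl = pointwise (λ _ → refl)

  ≐-sym : ∀ {a b} → a ≐ b → b ≐ a
  ≐-sym a≐b = pointwise (λ n → sym (at a≐b n))

  ≐-trans : ∀ {a b d} → a ≐ b → b ≐ d → a ≐ d
  ≐-trans a≐b b≐d = pointwise (λ n → trans (at a≐b n) (at b≐d n))

  infixl 6 _⊕_
  _⊕_ : Seq → Seq → Seq
  (a ⊕ b) n = a n + b n

  ∂ : Seq → Seq
  ∂ a n = a (suc n)

  δ₀≈0 : ∀ {d} → d ≢ 0 → δ₀ d ≈ 0#
  δ₀≈0 {zero}  d≢0 = ⊥-elim (d≢0 ≡.refl)
  δ₀≈0 {suc d} _   = refl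

  -- Convolution of exponential series

  conv-congᵢ : ∀ n {a a′ b b′} → (∀ i → i ≤ n → a i ≈ a′ i) → (∀ i → i ≤ n → b i ≈ b′ i) →
               conv a b n ≈ conv a′ b′ n
  conv-congᵢ n a≈a′ b≈b′ =
    sumTo-congᵢ n (λ i i≤n → *-congˡ (*-cong (a≈a′ i i≤n) (b≈b′ (n ∸ i) (ℕₚ.m∸n≤m n i))))

  conv-cong : ∀ {a a′ b b′} → a ≐ a′ → b ≐ b′ → conv a b ≐ conv a′ b′
  conv-cong a≐a′ b≐b′ = pointwise (λ n → conv-congᵢ n (λ i _ → at a≐a′ i) (λ i _ → at b≐b′ i))

  conv-congˡ : ∀ {a a′} b → a ≐ a′ → conv a b ≐ conv a′ b
  conv-congˡ b a≐a′ = conv-cong a≐a′ (≐-refl {b})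

  conv-congʳ : ∀ a {b b′} → b ≐ b′ → conv a b ≐ conv a b′
  conv-congʳ a b≐b′ = conv-cong (≐-refl {a}) b≐b′

  conv-0 : ∀ a b → conv a b 0 ≈ a 0 * b 0
  conv-0 a b = trans (*-congʳ natR-1) (*-identityˡ _)

  conv-∂ : ∀ a b → ∂ (conv a b) ≐ conv (∂ a) b ⊕ conv a (∂ b)
  conv-∂ a b = pointwise λ n →
    let term : ℕ → Carrier
        term i = natR (n C i) * (a i * b (suc n ∸ i))
        X : ℕ → Carrier
        X i = a (suc i) * b (n ∸ i)
        pascal : ∀ i → natR (suc n C suc i) * X i ≈ natR (n C i) * X i + natR (n C suc i) * X i
        pascal i = trans
          (*-congʳ (trans (natR-cong (≡.sym (nCk+nC[k+1]≡[n+1]C[k+1] n i))) (natR-+ (n C i) (n C suc i))))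
          (distribʳ _ _ _)
        top≈0 : term (suc n) ≈ 0#
        top≈0 = trans (*-congʳ (natR-cong (k>n⇒nCk≡0 (ℕₚ.n<1+n n)))) (zeroˡ _)
    in begin
    conv a b (suc n)
      ≈⟨ sumTo-shift n _ ⟩
    term 0 + sumTo n (λ i → natR (suc n C suc i) * X i)
      ≈⟨ +-congˡ (trans (sumTo-cong n pascal) (sumTo-+ n _ _)) ⟩
    term 0 + (conv (∂ a) b n + sumTo n (λ i → term (suc i)))
      ≈⟨ +-Props.x∙yz≈y∙xz _ _ _ ⟩
    conv (∂ a) b n + (term 0 + sumTo n (λ i → term (suc i)))
      ≈⟨ +-congˡ (sumTo-shift n term) ⟨
    conv (∂ a) b n + (sumTo n term + term (suc n))
      ≈⟨ +-congˡ (trans (+-congˡ top≈0) (+-identityʳ _)) ⟩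
    conv (∂ a) b n + sumTo n term
      ≈⟨ +-congˡ (sumTo-congᵢ n (λ i i≤n → *-congˡ (*-congˡ (reflexive (≡.cong b (ℕₚ.+-∸-assoc 1 i≤n)))))) ⟩
    conv (∂ a) b n + conv a (∂ b) n
      ∎

  conv-comm : ∀ a b → conv a b ≐ conv b a
  conv-comm a b = pointwise (λ n → go n a b)
    where
    go : ∀ n a b → conv a b n ≈ conv b a n
    go zero    a b = trans (conv-0 a b) (trans (*-comm _ _) (sym (conv-0 b a)))
    go (suc n) a b = begin
      conv a b (suc n)                ≈⟨ at (conv-∂ a b) n ⟩
      conv (∂ a) b n + conv a (∂ b) n ≈⟨ +-cong (go n (∂ a) b) (go n a (∂ b)) ⟩
      conv b (∂ a) n + conv (∂ b) a n ≈⟨ +-comm _ _ ⟩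
      conv (∂ b) a n + conv b (∂ a) n ≈⟨ at (conv-∂ b a) n ⟨
      conv b a (suc n)                ∎

  conv-⊕ˡ : ∀ a a′ b → conv (a ⊕ a′) b ≐ conv a b ⊕ conv a′ b
  conv-⊕ˡ a a′ b = pointwise λ n →
    trans (sumTo-cong n (λ i → trans (*-congˡ (distribʳ _ _ _)) (distribˡ _ _ _))) (sumTo-+ n _ _)

  conv-⊕ʳ : ∀ a b b′ → conv a (b ⊕ b′) ≐ conv a b ⊕ conv a b′
  conv-⊕ʳ a b b′ = pointwise λ n →
    trans (sumTo-cong n (λ i → trans (*-congˡ (distribˡ _ _ _)) (distribˡ _ _ _))) (sumTo-+ n _ _)

  conv-*ʳ : ∀ x a b n → conv a (λ m → x * b m) n ≈ x * conv a b n
  conv-*ʳ x a b n = trans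
    (sumTo-cong n (λ i → trans (*-congˡ (*-Props.x∙yz≈y∙xz _ x _)) (*-Props.x∙yz≈y∙xz _ x _)))
    (sym (sumTo-*ˡ n x _))

  conv-sumToʳ : ∀ a N (F : ℕ → Seq) n →
                conv a (λ m → sumTo N (λ k → F k m)) n ≈ sumTo N (λ k → conv a (F k) n)
  conv-sumToʳ a N F n = trans
    (sumTo-cong n (λ i → trans (*-congˡ (sumTo-*ˡ N (a i) _)) (sumTo-*ˡ N _ _)))
    (sumTo-swap n N (λ i k → natR (n C i) * (a i * F k (n ∸ i))))

  conv-assoc : ∀ a b d → conv (conv a b) d ≐ conv a (conv b d)
  conv-assoc a b d = pointwise (λ n → go n a b d)
    where
    go : ∀ n a b d → conv (conv a b) d n ≈ conv a (conv b d) n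
    go zero    a b d = begin
      conv (conv a b) d 0 ≈⟨ trans (conv-0 (conv a b) d) (*-congʳ (conv-0 a b)) ⟩
      a 0 * b 0 * d 0     ≈⟨ *-assoc _ _ _ ⟩
      a 0 * (b 0 * d 0)   ≈⟨ trans (conv-0 a (conv b d)) (*-congˡ (conv-0 b d)) ⟨
      conv a (conv b d) 0 ∎
    go (suc n) a b d = begin
      conv (conv a b) d (suc n)
        ≈⟨ at (conv-∂ (conv a b) d) n ⟩
      conv (∂ (conv a b)) d n + conv (conv a b) (∂ d) n
        ≈⟨ +-congʳ (at (≐-trans (conv-congˡ d (conv-∂ a b)) (conv-⊕ˡ (conv (∂ a) b) (conv a (∂ b)) d)) n) ⟩
      conv (conv (∂ a) b) d n + conv (conv a (∂ b)) d n + conv (conv a b) (∂ d) n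
        ≈⟨ +-cong (+-cong (go n (∂ a) b d) (go n a (∂ b) d)) (go n a b (∂ d)) ⟩
      conv (∂ a) (conv b d) n + conv a (conv (∂ b) d) n + conv a (conv b (∂ d)) n
        ≈⟨ +-assoc _ _ _ ⟩
      conv (∂ a) (conv b d) n + (conv a (conv (∂ b) d) n + conv a (conv b (∂ d)) n)
        ≈⟨ +-congˡ (at (≐-trans (conv-congʳ a (conv-∂ b d)) (conv-⊕ʳ a (conv (∂ b) d) (conv b (∂ d)))) n) ⟨
      conv (∂ a) (conv b d) n + conv a (∂ (conv b d)) n
        ≈⟨ at (conv-∂ a (conv b d)) n ⟨
      conv a (conv b d) (suc n)
        ∎

  conv-leftComm : ∀ a b d → conv a (conv b d) ≐ conv b (conv a d)
  conv-leftComm a b d =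
    ≐-trans (≐-sym (conv-assoc a b d))
      (≐-trans (conv-congˡ d (conv-comm a b)) (conv-assoc b a d))

  conv-identityʳ : ∀ a → conv a δ₀ ≐ a
  conv-identityʳ a = pointwise λ n → trans
    (sumTo-single n ℕₚ.≤-refl (λ i i≤n i≢n →
       trans (*-congˡ (trans (*-congˡ (δ₀≈0 (ℕₚ.m>n⇒m∸n≢0 (ℕₚ.≤∧≢⇒< i≤n i≢n)))) (zeroʳ _))) (zeroʳ _)))
    (trans (*-cong (trans (natR-cong (nCn≡1 n)) natR-1) (*-congˡ (reflexive (≡.cong δ₀ (ℕₚ.n∸n≡0 n)))))
           (trans (*-identityˡ _) (*-identityʳ _)))

  conv-identityˡ : ∀ a → conv δ₀ a ≐ a
  conv-identityˡ a = ≐-trans (conv-comm δ₀ a) (conv-identityʳ a)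

  conv-lowest : ∀ {a} b n → (∀ i → i < n → a i ≈ 0#) → conv a b n ≈ a n * b 0
  conv-lowest b n a≈0 = trans
    (sumTo-last n (λ i i<n → trans (*-congˡ (trans (*-congʳ (a≈0 i i<n)) (zeroˡ _))) (zeroʳ _)))
    (trans (*-cong (trans (natR-cong (nCn≡1 n)) natR-1) (*-congˡ (reflexive (≡.cong b (ℕₚ.n∸n≡0 n)))))
           (*-identityˡ _))

  dotPow-cong : ∀ k {a b} → a ≐ b → dotPow k a ≐ dotPow k b
  dotPow-cong zero    a≐b = ≐-refl
  dotPow-cong (suc k) a≐b = conv-cong a≐b (dotPow-cong k a≐b)

  bell-vanish : ∀ x k m → m < k → bell x k m ≈ 0#
  bell-vanish x (suc k) zero    _         = refl
  bell-vanish x (suc k) (suc m) (s≤s m<k) = sumTo-zero m (λ i _ →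
    trans (*-congˡ (trans (*-congˡ (bell-vanish x k (m ∸ i) (ℕₚ.≤-<-trans (ℕₚ.m∸n≤m m i) m<k))) (zeroʳ _)))
          (zeroʳ _))

  bell-diag : ∀ x l → bell x l l ≈ x 1 ^ l
  bell-diag x zero    = refl
  bell-diag x (suc l) = trans
    (sumTo-single l z≤n (λ i i≤l i≢0 →
       trans (*-congˡ (trans (*-congˡ (bell-vanish x l (l ∸ i) (ℕₚ.∸-monoʳ-< (ℕₚ.n≢0⇒n>0 i≢0) i≤l)))
                             (zeroʳ _)))
             (zeroʳ _)))
    (trans (*-congʳ natR-1) (trans (*-identityˡ _) (*-congˡ (bell-diag x l))))

  -- Composition of exponential series

  compose-cong : ∀ {F G} H → F ≐ G → compose F H ≐ compose G H
  compose-cong H F≐G = pointwise (λ n → sumTo-cong n (λ k → *-congʳ (at F≐G k)))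

  compose-⊕ : ∀ F G H → compose (F ⊕ G) H ≐ compose F H ⊕ compose G H
  compose-⊕ F G H = pointwise (λ n → trans (sumTo-cong n (λ k → distribʳ _ _ _)) (sumTo-+ n _ _))

  compose-0 : ∀ F H → compose F H 0 ≈ F 0
  compose-0 F H = *-identityʳ _

  compose-δ₀ : ∀ H → compose δ₀ H ≐ δ₀
  compose-δ₀ H = pointwise λ n → trans
    (sumTo-single n z≤n (λ k _ k≢0 → trans (*-congʳ (δ₀≈0 k≢0)) (zeroˡ _)))
    (trans (*-identityˡ _) (bell-0 n))
    where
    bell-0 : ∀ n → bell H 0 n ≈ δ₀ n
    bell-0 zero    = refl
    bell-0 (suc n) = refl

  compose-extend : ∀ F H {m n} → m ≤ n → sumTo n (λ k → F k * bell H k m) ≈ compose F H m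
  compose-extend F H {m} {n} m≤n =
    sumTo-truncate n m≤n (λ k m<k _ → trans (*-congˡ (bell-vanish H k m m<k)) (zeroʳ _))

  -- The chain rule; the recursion defining bell is itself a convolution with ∂ H.
  compose-∂ : ∀ F H → ∂ (compose F H) ≐ conv (∂ H) (compose (∂ F) H)
  compose-∂ F H = pointwise λ n → begin
    compose F H (suc n)
      ≈⟨ trans (sumTo-shift n _) (trans (+-congʳ (zeroʳ _)) (+-identityˡ _)) ⟩
    sumTo n (λ k → F (suc k) * conv (∂ H) (bell H k) n)
      ≈⟨ sumTo-cong n (λ k → conv-*ʳ (F (suc k)) (∂ H) (bell H k) n) ⟨
    sumTo n (λ k → conv (∂ H) (λ m → F (suc k) * bell H k m) n)
      ≈⟨ conv-sumToʳ (∂ H) n (λ k m → F (suc k) * bell H k m) n ⟨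
    conv (∂ H) (λ m → sumTo n (λ k → F (suc k) * bell H k m)) n
      ≈⟨ conv-congᵢ n (λ _ _ → refl) (λ m m≤n → compose-extend (∂ F) H m≤n) ⟩
    conv (∂ H) (compose (∂ F) H) n
      ∎

  compose-conv : ∀ F G H → compose (conv F G) H ≐ conv (compose F H) (compose G H)
  compose-conv F G H = pointwise (λ n → <-rec P step n F G)
    where
    P : ℕ → Set (c ⊔ ℓ)
    P n = ∀ F G → compose (conv F G) H n ≈ conv (compose F H) (compose G H) n
    step : ∀ n → (∀ {m} → m < n → P m) → P n
    step zero    _  F G = begin
      compose (conv F G) H 0            ≈⟨ trans (compose-0 (conv F G) H) (conv-0 F G) ⟩
      F 0 * G 0                         ≈⟨ *-cong (compose-0 F H) (compose-0 G H) ⟨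
      compose F H 0 * compose G H 0     ≈⟨ conv-0 (compose F H) (compose G H) ⟨
      conv (compose F H) (compose G H) 0 ∎
    step (suc n) ih F G = begin
      compose (conv F G) H (suc n)
        ≈⟨ at (compose-∂ (conv F G) H) n ⟩
      conv (∂ H) (compose (∂ (conv F G)) H) n
        ≈⟨ conv-congᵢ n (λ _ _ → refl) (λ m m≤n →
             trans (at (≐-trans (compose-cong H (conv-∂ F G)) (compose-⊕ (conv (∂ F) G) (conv F (∂ G)) H)) m)
                   (+-cong (ih (s≤s m≤n) (∂ F) G) (ih (s≤s m≤n) F (∂ G)))) ⟩
      conv (∂ H) (conv cF′ cG ⊕ conv cF cG′) n
        ≈⟨ at (conv-⊕ʳ (∂ H) (conv cF′ cG) (conv cF cG′)) n ⟩
      conv (∂ H) (conv cF′ cG) n + conv (∂ H) (conv cF cG′) n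
        ≈⟨ +-cong (at (conv-assoc (∂ H) cF′ cG) n) (at (conv-leftComm cF (∂ H) cG′) n) ⟨
      conv (conv (∂ H) cF′) cG n + conv cF (conv (∂ H) cG′) n
        ≈⟨ +-cong (at (conv-congˡ cG (compose-∂ F H)) n) (at (conv-congʳ cF (compose-∂ G H)) n) ⟨
      conv (∂ cF) cG n + conv cF (∂ cG) n
        ≈⟨ at (conv-∂ cF cG) n ⟨
      conv cF cG (suc n)
        ∎
      where
      cF cG cF′ cG′ : Seq
      cF = compose F H
      cG = compose G H
      cF′ = compose (∂ F) H
      cG′ = compose (∂ G) H

  compose-1 : ∀ F H → compose F H 1 ≈ H 1 * F 1
  compose-1 F H = trans (at (compose-∂ F H) 0)
    (trans (conv-0 (∂ H) (compose (∂ F) H)) (*-congˡ (compose-0 (∂ F) H)))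

  compose-dotPow : ∀ k g H → compose (dotPow k g) H ≐ dotPow k (compose g H)
  compose-dotPow zero    g H = compose-δ₀ H
  compose-dotPow (suc k) g H =
    ≐-trans (compose-conv g (dotPow k g) H) (conv-congʳ (compose g H) (compose-dotPow k g H))

  conv-χseq-0 : ∀ X → conv χseq X 0 ≈ X 0
  conv-χseq-0 X = trans (conv-0 χseq X) (*-identityˡ _)

  conv-χseq-suc : ∀ X n → conv χseq X (suc n) ≈ X (suc n) + natR (suc n) * X n
  conv-χseq-suc X n = trans (sumTo-shift n _) (+-cong constant linear)
    where
    constant : natR (suc n C 0) * (1# * X (suc n)) ≈ X (suc n)
    constant = trans (*-congʳ natR-1) (trans (*-identityˡ _) (*-identityˡ _))
    higher : ∀ i → i ≤ n → i ≢ 0 → natR (suc n C suc i) * (χseq (suc i) * X (n ∸ i)) ≈ 0#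
    higher zero    _ 0≢0 = ⊥-elim (0≢0 ≡.refl)
    higher (suc i) _ _   = trans (*-congˡ (zeroˡ _)) (zeroʳ _)
    linear : sumTo n (λ i → natR (suc n C suc i) * (χseq (suc i) * X (n ∸ i))) ≈ natR (suc n) * X n
    linear = trans (sumTo-single n z≤n higher) (*-cong (natR-cong (nC1≡n (suc n))) (*-identityˡ _))

  dotPow-χseq : ∀ k → dotPow k χseq ≐ (λ n → natR (falling k n))
  dotPow-χseq k = pointwise (go k)
    where
    go : ∀ k n → dotPow k χseq n ≈ natR (falling k n)
    go zero    zero    = sym natR-1
    go zero    (suc n) = sym (natR-cong (falling-zero {0} {suc n} (s≤s z≤n)))
    go (suc k) zero    = trans (conv-χseq-0 (dotPow k χseq)) (go k zero)
    go (suc k) (suc n) = begin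
      conv χseq (dotPow k χseq) (suc n)
        ≈⟨ conv-χseq-suc (dotPow k χseq) n ⟩
      dotPow k χseq (suc n) + natR (suc n) * dotPow k χseq n
        ≈⟨ +-cong (go k (suc n)) (*-congˡ (go k n)) ⟩
      natR (falling k (suc n)) + natR (suc n) * natR (falling k n)
        ≈⟨ +-congˡ (natR-* (suc n) (falling k n)) ⟨
      natR (falling k (suc n)) + natR (suc n ℕ.* falling k n)
        ≈⟨ natR-+ (falling k (suc n)) (suc n ℕ.* falling k n) ⟨
      natR (falling k (suc n) ℕ.+ suc n ℕ.* falling k n)
        ≈⟨ natR-cong (falling-pascal k n) ⟨
      natR (falling (suc k) (suc n))
        ∎

  recipSeries-inverse : conv χseq recipSeries ≐ δ₀
  recipSeries-inverse = pointwise go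
    where
    go : ∀ n → conv χseq recipSeries n ≈ δ₀ n
    go zero    = trans (conv-χseq-0 recipSeries) (trans (*-identityˡ _) natR-1)
    go (suc n) = begin
      conv χseq recipSeries (suc n)
        ≈⟨ conv-χseq-suc recipSeries n ⟩
      - sign n * natR (suc n ℕ.* n !) + natR (suc n) * (sign n * natR (n !))
        ≈⟨ +-cong (trans (*-congˡ (natR-* (suc n) (n !))) (sym (-‿distribˡ-* _ _)))
                  (*-Props.x∙yz≈y∙xz _ _ _) ⟩
      - (sign n * (natR (suc n) * natR (n !))) + sign n * (natR (suc n) * natR (n !))
        ≈⟨ -‿inverseˡ _ ⟩
      0#
        ∎

  compose-χseq : ∀ {a} → a 0 ≈ 1# → compose χseq a ≐ a
  compose-χseq {a} a₀≈1 = pointwise go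
    where
    ∂χseq : ∂ χseq ≐ δ₀
    ∂χseq = pointwise λ { zero → refl ; (suc n) → refl }
    go : ∀ n → compose χseq a n ≈ a n
    go zero    = trans (compose-0 χseq a) (sym a₀≈1)
    go (suc n) = begin
      compose χseq a (suc n)
        ≈⟨ at (compose-∂ χseq a) n ⟩
      conv (∂ a) (compose (∂ χseq) a) n
        ≈⟨ at (conv-congʳ (∂ a) (≐-trans (compose-cong a ∂χseq) (compose-δ₀ a))) n ⟩
      conv (∂ a) δ₀ n
        ≈⟨ at (conv-identityʳ (∂ a)) n ⟩
      a (suc n)
        ∎

  negDot-inverse : ∀ {a} → a 0 ≈ 1# → conv (negDot a) a ≐ δ₀
  negDot-inverse {a} a₀≈1 = pointwise λ n → begin
    conv (negDot a) a n
      ≈⟨ at (conv-congʳ (negDot a) (compose-χseq a₀≈1)) n ⟨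
    conv (compose recipSeries a) (compose χseq a) n
      ≈⟨ at (compose-conv recipSeries χseq a) n ⟨
    compose (conv recipSeries χseq) a n
      ≈⟨ at (compose-cong a (≐-trans (conv-comm recipSeries χseq) recipSeries-inverse)) n ⟩
    compose δ₀ a n
      ≈⟨ at (compose-δ₀ a) n ⟩
    δ₀ n
      ∎

  -- When Σ s_n(x) tⁿ/n! = N(t) e^{x h(t)}, the value E[s_n(ω)] is the n-th coefficient of N(t) f(ω, h(t)).
  evalPoly-sheffer : ∀ N h (s : ℕ → ℕ → Carrier) → (∀ n j → s n j ≈ conv (bell h j) N n) →
                     ∀ n M → evalPoly s n M ≈ conv N (compose M h) n
  evalPoly-sheffer N h s s≈ n M = begin
    sumTo n (λ j → s n j * M j)
      ≈⟨ sumTo-cong n (λ j → trans (*-comm _ _) (*-congˡ (trans (s≈ n j) (at (conv-comm (bell h j) N) n)))) ⟩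
    sumTo n (λ j → M j * conv N (bell h j) n)
      ≈⟨ sumTo-cong n (λ j → conv-*ʳ (M j) N (bell h j) n) ⟨
    sumTo n (λ j → conv N (λ i → M j * bell h j i) n)
      ≈⟨ conv-sumToʳ N n (λ j i → M j * bell h j i) n ⟨
    conv N (λ i → sumTo n (λ j → M j * bell h j i)) n
      ≈⟨ conv-congᵢ n (λ _ _ → refl) (λ i i≤n → compose-extend M h i≤n) ⟩
    conv N (compose M h) n
      ∎

  sheffer-characterizes : ∀ a g h s → a 0 ≈ 1# → (∀ n → compose g h n ≈ χseq n) →
                          IsShefferMoments a h s → Characterizes a g s
  sheffer-characterizes a g h s a₀≈1 g∘h≈χ (_ , s≈) n k = begin
    evalPoly s n (conv a (dotPow k g))
      ≈⟨ evalPoly-sheffer N h s s≈ n (conv a (dotPow k g)) ⟩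
    conv N (compose (conv a (dotPow k g)) h) n
      ≈⟨ at (conv-congʳ N moments) n ⟩
    conv N (conv (compose a h) (dotPow k χseq)) n
      ≈⟨ at (conv-assoc N (compose a h) (dotPow k χseq)) n ⟨
    conv (conv N (compose a h)) (dotPow k χseq) n
      ≈⟨ at (conv-congˡ (dotPow k χseq) cancel) n ⟩
    conv δ₀ (dotPow k χseq) n
      ≈⟨ at (≐-trans (conv-identityˡ (dotPow k χseq)) (dotPow-χseq k)) n ⟩
    natR (falling k n)
      ∎
    where
    N : Seq
    N = compose (negDot a) h
    moments : compose (conv a (dotPow k g)) h ≐ conv (compose a h) (dotPow k χseq)
    moments = ≐-trans (compose-conv a (dotPow k g) h) (conv-congʳ (compose a h)
                (≐-trans (compose-dotPow k g h) (dotPow-cong k (pointwise g∘h≈χ))))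
    cancel : conv N (compose a h) ≐ δ₀
    cancel = ≐-trans (≐-sym (compose-conv (negDot a) a h))
               (≐-trans (compose-cong h (negDot-inverse a₀≈1)) (compose-δ₀ h))

  -- Triangular families and uniqueness

  IsTriangular : (ℕ → ℕ → Carrier) → Set ℓ
  IsTriangular p = ∀ n j → n < j → p n j ≈ 0#

  natR-nonZero : HasCharZero R → ∀ {m} → NonZero m → ¬ natR m ≈ 0#
  natR-nonZero char0 {suc m} _ = char0 m

  falling-independent : IsIntegralDomain R → HasCharZero R → ∀ n (coeff : Seq) →
                        (∀ k → sumTo n (λ l → coeff l * natR (falling k l)) ≈ 0#) →
                        ∀ l → l ≤ n → coeff l ≈ 0#
  falling-independent (_ , noZeroDivisors) char0 n coeff vanishes = <-rec (λ l → l ≤ n → coeff l ≈ 0#) step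
    where
    step : ∀ l → (∀ {i} → i < l → i ≤ n → coeff i ≈ 0#) → l ≤ n → coeff l ≈ 0#
    step l ih l≤n with noZeroDivisors (coeff l) (natR (falling l l)) leading
      where
      others : ∀ i → i ≤ n → i ≢ l → coeff i * natR (falling l i) ≈ 0#
      others i i≤n i≢l with ℕₚ.<-cmp i l
      ... | tri< i<l _ _ = trans (*-congʳ (ih i<l i≤n)) (zeroˡ _)
      ... | tri≈ _ i≡l _ = ⊥-elim (i≢l i≡l)
      ... | tri> _ _ l<i = trans (*-congˡ (natR-cong (falling-zero l<i))) (zeroʳ _)
      leading : coeff l * natR (falling l l) ≈ 0#
      leading = trans (sym (sumTo-single n l≤n others)) (vanishes l)
    ... | inj₁ coeff≈0 = coeff≈0
    ... | inj₂ l!≈0    = ⊥-elim (natR-nonZero char0 (falling-nonZero {l} {l} ℕₚ.≤-refl) l!≈0)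

  module _ (s : ℕ → ℕ → Carrier) (s-triangular : IsTriangular s)
           (u : Seq) (u-inverse : ∀ l → u l * s l l ≈ 1#) where

    triangular-expansion : ∀ m (q : Seq) → (∀ j → m < j → q j ≈ 0#) →
                           Σ[ coeff ∈ Seq ] (∀ j → q j ≈ sumTo m (λ l → coeff l * s l j))
    triangular-expansion zero q q-deg = (λ _ → q 0 * u 0) , expansion
      where
      expansion : ∀ j → q j ≈ q 0 * u 0 * s 0 j
      expansion zero    = sym (trans (*-assoc _ _ _) (trans (*-congˡ (u-inverse 0)) (*-identityʳ _)))
      expansion (suc j) = trans (q-deg (suc j) (s≤s z≤n))
        (sym (trans (*-congˡ (s-triangular 0 (suc j) (s≤s z≤n))) (zeroʳ _)))
    triangular-expansion (suc m) q q-deg = coeff , expansion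
      where
      e : Carrier
      e = q (suc m) * u (suc m)
      q′ : Seq
      q′ j = q j - e * s (suc m) j
      q′-deg : ∀ j → m < j → q′ j ≈ 0#
      q′-deg j m<j with ℕₚ.m≤n⇒m<n∨m≡n m<j
      ... | inj₂ ≡.refl = x≈y⇒x∙y⁻¹≈ε
        (sym (trans (*-assoc _ _ _) (trans (*-congˡ (u-inverse (suc m))) (*-identityʳ _))))
      ... | inj₁ m+1<j  = x≈y⇒x∙y⁻¹≈ε
        (trans (q-deg j m+1<j) (sym (trans (*-congˡ (s-triangular (suc m) j m+1<j)) (zeroʳ e))))
      coeff′ : Seq
      coeff′ = proj₁ (triangular-expansion m q′ q′-deg)
      coeff : Seq
      coeff l with l ℕ.≟ suc m
      ... | yes _ = e
      ... | no  _ = coeff′ l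
      coeff-below : ∀ l → l ≤ m → coeff l ≈ coeff′ l
      coeff-below l l≤m with l ℕ.≟ suc m
      ... | yes l≡1+m = ⊥-elim (ℕₚ.<⇒≢ (s≤s l≤m) l≡1+m)
      ... | no  _     = refl
      coeff-top : coeff (suc m) ≈ e
      coeff-top with suc m ℕ.≟ suc m
      ... | yes _   = refl
      ... | no  1+m≢1+m = ⊥-elim (1+m≢1+m ≡.refl)
      expansion : ∀ j → q j ≈ sumTo (suc m) (λ l → coeff l * s l j)
      expansion j = begin
        q j
          ≈⟨ //-rightDividesˡ (e * s (suc m) j) (q j) ⟨
        q′ j + e * s (suc m) j
          ≈⟨ +-cong (proj₂ (triangular-expansion m q′ q′-deg) j) (*-congʳ (sym coeff-top)) ⟩
        sumTo m (λ l → coeff′ l * s l j) + coeff (suc m) * s (suc m) j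
          ≈⟨ +-congʳ (sumTo-congᵢ m (λ l l≤m → *-congʳ (coeff-below l l≤m))) ⟨
        sumTo (suc m) (λ l → coeff l * s l j)
          ∎

    sumTo-evalPoly : ∀ n (coeff m : Seq) →
                     sumTo n (λ l → coeff l * evalPoly s l m) ≈
                     sumTo n (λ j → sumTo n (λ l → coeff l * s l j) * m j)
    sumTo-evalPoly n coeff m = begin
      sumTo n (λ l → coeff l * evalPoly s l m)
        ≈⟨ sumTo-congᵢ n (λ l l≤n → *-congˡ (sumTo-truncate n l≤n (λ j l<j _ →
             trans (*-congʳ (s-triangular l j l<j)) (zeroˡ _)))) ⟨
      sumTo n (λ l → coeff l * sumTo n (λ j → s l j * m j))
        ≈⟨ sumTo-cong n (λ l → sumTo-*ˡ n (coeff l) _) ⟩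
      sumTo n (λ l → sumTo n (λ j → coeff l * (s l j * m j)))
        ≈⟨ sumTo-swap n n _ ⟩
      sumTo n (λ j → sumTo n (λ l → coeff l * (s l j * m j)))
        ≈⟨ sumTo-cong n (λ j → trans (sumTo-*ʳ n (m j) _) (sumTo-cong n (λ l → *-assoc _ _ _))) ⟨
      sumTo n (λ j → sumTo n (λ l → coeff l * s l j) * m j)
        ∎

    triangular-unique : IsIntegralDomain R → HasCharZero R → (M : ℕ → Seq) →
                        (∀ n k → evalPoly s n (M k) ≈ natR (falling k n)) →
                        ∀ p → IsTriangular p → (∀ n k → evalPoly p n (M k) ≈ natR (falling k n)) →
                        ∀ n j → p n j ≈ s n j
    triangular-unique domain char0 M s-char p p-triangular p-char n j =
      x∙y⁻¹≈ε⇒x≈y (p n j) (s n j)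
        (trans (proj₂ expanded j) (sumTo-zero n (λ l l≤n → trans (*-congʳ (coeff≈0 l l≤n)) (zeroˡ _))))
      where
      q : Seq
      q i = p n i - s n i
      q-deg : ∀ i → n < i → q i ≈ 0#
      q-deg i n<i = x≈y⇒x∙y⁻¹≈ε (trans (p-triangular n i n<i) (sym (s-triangular n i n<i)))
      expanded : Σ[ coeff ∈ Seq ] (∀ i → q i ≈ sumTo n (λ l → coeff l * s l i))
      expanded = triangular-expansion n q q-deg
      coeff : Seq
      coeff = proj₁ expanded
      vanishes : ∀ k → sumTo n (λ l → coeff l * natR (falling k l)) ≈ 0#
      vanishes k = begin
        sumTo n (λ l → coeff l * natR (falling k l))
          ≈⟨ sumTo-cong n (λ l → *-congˡ (s-char l k)) ⟨
        sumTo n (λ l → coeff l * evalPoly s l (M k))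
          ≈⟨ sumTo-evalPoly n coeff (M k) ⟩
        sumTo n (λ i → sumTo n (λ l → coeff l * s l i) * M k i)
          ≈⟨ sumTo-cong n (λ i → *-congʳ (proj₂ expanded i)) ⟨
        sumTo n (λ i → q i * M k i)
          ≈⟨ sumTo-cong n (λ i → [y-z]x≈yx-zx (M k i) (p n i) (s n i)) ⟩
        sumTo n (λ i → p n i * M k i - s n i * M k i)
          ≈⟨ sumTo-- n _ _ ⟩
        evalPoly p n (M k) - evalPoly s n (M k)
          ≈⟨ x≈y⇒x∙y⁻¹≈ε (trans (p-char n k) (sym (s-char n k))) ⟩
        0#
          ∎
      coeff≈0 : ∀ l → l ≤ n → coeff l ≈ 0#
      coeff≈0 = falling-independent domain char0 n coeff vanishes

  sheffer-diagonal : ∀ a h s → IsShefferMoments a h s → ∀ l → s l l ≈ h 1 ^ l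
  sheffer-diagonal a h s (_ , s≈) l = begin
    s l l               ≈⟨ s≈ l l ⟩
    conv (bell h l) N l ≈⟨ conv-lowest N l (bell-vanish h l) ⟩
    bell h l l * N 0    ≈⟨ *-cong (bell-diag h l) N₀≈1 ⟩
    h 1 ^ l * 1#        ≈⟨ *-identityʳ _ ⟩
    h 1 ^ l             ∎
    where
    N : Seq
    N = compose (negDot a) h
    N₀≈1 : N 0 ≈ 1#
    N₀≈1 = trans (compose-0 (negDot a) h) (trans (compose-0 recipSeries a) (trans (*-identityˡ _) natR-1))

  sheffer-unique : IsIntegralDomain R → HasCharZero R → ∀ a g h s → a 0 ≈ 1# →
                   (∀ n → compose g h n ≈ χseq n) → IsShefferMoments a h s →
                   ∀ p → IsPolySeq p → Characterizes a g p → ∀ n j → p n j ≈ s n j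
  sheffer-unique domain char0 a g h s a₀≈1 g∘h≈χ sheffer p (p-triangular , _) =
    triangular-unique s (proj₁ (proj₁ (proj₁ sheffer))) (λ l → g 1 ^ l) unit domain char0
      (λ k → conv a (dotPow k g)) (sheffer-characterizes a g h s a₀≈1 g∘h≈χ sheffer) p p-triangular
    where
    g₁h₁≈1 : g 1 * h 1 ≈ 1#
    g₁h₁≈1 = trans (*-comm _ _) (trans (sym (compose-1 g h)) (g∘h≈χ 1))
    unit : ∀ l → g 1 ^ l * s l l ≈ 1#
    unit l = trans (*-congˡ (sheffer-diagonal a h s sheffer l)) (^-inverse g₁h₁≈1 l)

theorem5p2 : ∀ {c ℓ} (R : CommutativeRing c ℓ) → IsIntegralDomain R → HasCharZero R →
    let open CommutativeRing R in
    let open Umbral R in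
    (a g h : Seq) (s : ℕ → ℕ → Carrier) →
    IsScalarUmbra a → IsScalarUmbra g → HasCompInverse g h →
    IsShefferMoments a h s →
    Characterizes a g s
    × (∀ (p : ℕ → ℕ → Carrier) → IsPolySeq p → Characterizes a g p → ∀ n j → p n j ≈ s n j)
theorem5p2 R domain char0 a g h s a₀≈1 _ (_ , _ , g∘h≈χ , _) sheffer =
  sheffer-characterizes a g h s a₀≈1 g∘h≈χ sheffer ,
  sheffer-unique domain char0 a g h s a₀≈1 g∘h≈χ sheffer
  where open Series R
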